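{- For all integers $m,n\geq 1$, $$\mathrm{v}(m+n)=\mathrm{v}(m)\,\mathrm{v}(n)+\sum_{\substack{a+b=m+n-2^{s}\\ 0\le a<m,\ 0\le b<n,\ s\geq 1}}\mathrm{v}(a)\,\mathrm{v}(b),$$ the sum running over all triples of integers $(a,b,s)$ with the indicated constraints. In particular, for $n\ge1$, $$\mathrm{v}(2n)=\mathrm{v}(n)^{2}+\sum_{\substack{a+b=2n-2^{s}\\ 0\le a,b<n,\ s\geq 1}}\mathrm{v}(a)\,\mathrm{v}(b).$$
   Context: For a positive integer $n$, $\mathrm{v}(n)$ denotes the number of compositions (ordered partitions) of $n$ into powers of $2$, i.e. the number of finite sequences $(q_1,\ldots,q_\ell)$ of non-negative integers with $n=2^{q_1}+\cdots+2^{q_\ell}$. By convention $\mathrm{v}(0)=1$. -}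

module Defs where

open import Data.Nat using (ℕ; zero; suc; _+_; _*_; _∸_; _^_; _≤_; _<_; _≤?_; _≟_)
open import Data.List using (List; []; _∷_; map; concatMap; length; upTo)
open import Data.Nat.ListAction using (sum)
open import Relation.Nullary using (yes; no)

-- Explicit enumeration of compositions of n into powers of 2:
-- sequences (q₁,…,qℓ) with n = 2^q₁ + … + 2^qℓ.
-- A composition of n > 0 is a first part 2^q with 2^q ≤ n (so q < n+1 suffices)
-- followed by a composition of n ∸ 2^q.  'fuel' bounds the recursion depth
-- (every part is ≥ 1, so fuel = n suffices).
compsF : ℕ → ℕ → List (List ℕ)
compsF fuel zero = [] ∷ []
compsF zero (suc _) = []
compsF (suc fuel) (suc k) =
  concatMap (λ q → firstPart q (2 ^ q ≤? suc k)) (upTo (suc (suc k)))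
  where
  firstPart : (q : ℕ) → _ → List (List ℕ)
  firstPart q (yes _) = map (q ∷_) (compsF fuel (suc k ∸ 2 ^ q))
  firstPart q (no _)  = []

compositions : ℕ → List (List ℕ)
compositions n = compsF n n

v : ℕ → ℕ
v n = length (compositions n)

SumPow2 : List ℕ → ℕ
SumPow2 qs = sum (map (2 ^_) qs)

Σ< : ℕ → (ℕ → ℕ) → ℕ
Σ< zero f = 0
Σ< (suc n) f = Σ< n f + f n

[_≡ᵇ_] : ℕ → ℕ → ℕ
[ x ≡ᵇ y ] with x ≟ y
... | yes _ = 1
... | no _ = 0

-- Σ over triples (a,b,s) with 0 ≤ a < m, 0 ≤ b < n, s ≥ 1, a + b = m + n - 2^s
-- of v(a) v(b).  Since 2^s ≤ m + n forces s < m + n + 1, ranging s over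
-- 1 ≤ s ≤ m + n captures all triples.
extraSum : ℕ → ℕ → ℕ
extraSum m n =
  Σ< m λ a → Σ< n λ b → Σ< (m + n) λ s' →
    [ a + b + 2 ^ suc s' ≡ᵇ m + n ] * (v a * v b)

-- Splitting off the first part of a composition gives
--   v(k+1) = v(k) + Σ { v(a) | a < k, s ≥ 1, a + 2^s = k + 1 }.
-- Put F(m, n) = v(m) v(n) + E(m, n), where E is the sum on the right-hand side of the
-- theorem with the target m + n held fixed. Expanding v(n+1) in F(m, n+1) and v(m+1)
-- in F(m+1, n) by the recursion, both become v(m) v(n) + E(m, n) plus the row a = m and
-- the column b = n of E, so F depends on m + n only; as F(0, n) = v(n), F(m, n) = v(m + n).
module Submission where

open import Defs
open import Data.Nat using (ℕ; zero; suc; _+_; _*_; _^_; _∸_; _≤_; _<_; _≥_; _≤?_; _≟_; z≤n; s≤s; s≤s⁻¹)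
open import Data.Product using (_×_; _,_)
open import Data.Nat.Properties
open import Data.List using (List; []; _∷_; _++_; [_]; map; concatMap; length; upTo; applyUpTo)
open import Data.List.Properties using (length-++; length-map; ++-identityʳ; concatMap-cong; concatMap-++; applyUpTo-∷ʳ)
open import Data.Empty using (⊥-elim)
open import Data.Sum using (inj₁; inj₂)
open import Function using (id; _∘_)
open import Relation.Nullary using (Dec; yes; no)
open import Relation.Binary.PropositionalEquality
  using (_≡_; _≢_; ≢-sym; refl; sym; trans; cong; cong₂; subst; module ≡-Reasoning)
import Algebra.Properties.CommutativeSemigroup as CommutativeSemigroupProperties

open CommutativeSemigroupProperties +-commutativeSemigroup using (interchange; xy∙z≈xz∙y)
open CommutativeSemigroupProperties *-commutativeSemigroup using (x∙yz≈y∙xz)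

indicator-refl : ∀ x → [ x ≡ᵇ x ] ≡ 1
indicator-refl x with x ≟ x
... | yes _  = refl
... | no x≢x = ⊥-elim (x≢x refl)

indicator-≢ : ∀ {x y} → x ≢ y → [ x ≡ᵇ y ] ≡ 0
indicator-≢ {x} {y} x≢y with x ≟ y
... | yes x≡y = ⊥-elim (x≢y x≡y)
... | no _    = refl

indicator-cong : ∀ {x y x′ y′} → (x ≡ y → x′ ≡ y′) → (x′ ≡ y′ → x ≡ y) →
                 [ x ≡ᵇ y ] ≡ [ x′ ≡ᵇ y′ ]
indicator-cong {x} {y} {x′} {y′} to from with x ≟ y | x′ ≟ y′
... | yes _   | yes _    = refl
... | no _    | no _     = refl
... | yes x≡y | no x′≢y′ = ⊥-elim (x′≢y′ (to x≡y))
... | no x≢y  | yes x′≡y′ = ⊥-elim (x≢y (from x′≡y′))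

indicator-+ʳ : ∀ d x y → [ x + d ≡ᵇ y + d ] ≡ [ x ≡ᵇ y ]
indicator-+ʳ d x y = indicator-cong (+-cancelʳ-≡ d x y) (cong (_+ d))

Σ<-cong : ∀ n {f g : ℕ → ℕ} → (∀ i → i < n → f i ≡ g i) → Σ< n f ≡ Σ< n g
Σ<-cong zero    f≗g = refl
Σ<-cong (suc n) f≗g = cong₂ _+_ (Σ<-cong n (λ i i<n → f≗g i (m<n⇒m<1+n i<n))) (f≗g n ≤-refl)

Σ<-zero : ∀ n {f : ℕ → ℕ} → (∀ i → i < n → f i ≡ 0) → Σ< n f ≡ 0
Σ<-zero zero    f≗0 = refl
Σ<-zero (suc n) f≗0 =
  cong₂ _+_ (Σ<-zero n (λ i i<n → f≗0 i (m<n⇒m<1+n i<n))) (f≗0 n ≤-refl)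

Σ<-head : ∀ n (f : ℕ → ℕ) → Σ< (suc n) f ≡ f 0 + Σ< n (λ i → f (suc i))
Σ<-head zero    f = +-comm 0 (f 0)
Σ<-head (suc n) f = trans (cong (_+ f (suc n)) (Σ<-head n f)) (+-assoc (f 0) _ _)

Σ<-distrib-+ : ∀ n (f g : ℕ → ℕ) → Σ< n (λ i → f i + g i) ≡ Σ< n f + Σ< n g
Σ<-distrib-+ zero    f g = refl
Σ<-distrib-+ (suc n) f g =
  trans (cong (_+ (f n + g n)) (Σ<-distrib-+ n f g)) (interchange (Σ< n f) (Σ< n g) (f n) (g n))

Σ<-distribˡ-* : ∀ n x (f : ℕ → ℕ) → x * Σ< n f ≡ Σ< n (λ i → x * f i)
Σ<-distribˡ-* zero    x f = *-zeroʳ x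
Σ<-distribˡ-* (suc n) x f =
  trans (*-distribˡ-+ x (Σ< n f) (f n)) (cong (_+ x * f n) (Σ<-distribˡ-* n x f))

Σ<-distribʳ-* : ∀ n x (f : ℕ → ℕ) → Σ< n f * x ≡ Σ< n (λ i → f i * x)
Σ<-distribʳ-* zero    x f = refl
Σ<-distribʳ-* (suc n) x f =
  trans (*-distribʳ-+ x (Σ< n f) (f n)) (cong (_+ f n * x) (Σ<-distribʳ-* n x f))

Σ<-swap : ∀ m n (f : ℕ → ℕ → ℕ) → Σ< m (λ i → Σ< n (f i)) ≡ Σ< n (λ j → Σ< m (λ i → f i j))
Σ<-swap zero    n f = sym (Σ<-zero n (λ _ _ → refl))
Σ<-swap (suc m) n f =
  trans (cong (_+ Σ< n (f m)) (Σ<-swap m n f)) (sym (Σ<-distrib-+ n (λ j → Σ< m (λ i → f i j)) (f m)))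

Σ<-extend : ∀ {n K} (f : ℕ → ℕ) → n ≤ K → (∀ i → n ≤ i → f i ≡ 0) → Σ< K f ≡ Σ< n f
Σ<-extend {K = zero}  f z≤n _   = refl
Σ<-extend {n} {suc K} f n≤1+K f≗0 with m≤n⇒m<n∨m≡n n≤1+K
... | inj₁ n≤K = trans (cong₂ _+_ (Σ<-extend f (s≤s⁻¹ n≤K) f≗0) (f≗0 K (s≤s⁻¹ n≤K))) (+-identityʳ _)
... | inj₂ refl = refl

Σ<-pick : ∀ {n c} (f : ℕ → ℕ) → c < n → Σ< n (λ a → [ a ≡ᵇ c ] * f a) ≡ f c
Σ<-pick {suc n} {c} f c<1+n with m≤n⇒m<n∨m≡n (s≤s⁻¹ c<1+n)
... | inj₁ c<n = begin
  Σ< n (λ a → [ a ≡ᵇ c ] * f a) + [ n ≡ᵇ c ] * f n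
    ≡⟨ cong₂ _+_ (Σ<-pick f c<n) (cong (_* f n) (indicator-≢ (≢-sym (<⇒≢ c<n)))) ⟩
  f c + 0
    ≡⟨ +-identityʳ (f c) ⟩
  f c ∎
  where open ≡-Reasoning
... | inj₂ refl = begin
  Σ< n (λ a → [ a ≡ᵇ n ] * f a) + [ n ≡ᵇ n ] * f n
    ≡⟨ cong₂ _+_ (Σ<-zero n (λ a a<n → cong (_* f a) (indicator-≢ (<⇒≢ a<n))))
                 (cong (_* f n) (indicator-refl n)) ⟩
  0 + (f n + 0)
    ≡⟨ +-identityʳ (f n) ⟩
  f n ∎
  where open ≡-Reasoning

n<2^n : ∀ n → n < 2 ^ n
n<2^n zero    = s≤s z≤n
n<2^n (suc n) = begin-strict
  suc n           ≤⟨ n<2^n n ⟩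
  2 ^ n           <⟨ m<m+n (2 ^ n) (m^n>0 2 n) ⟩
  2 ^ n + 2 ^ n   ≡⟨ cong (2 ^ n +_) (sym (+-identityʳ (2 ^ n))) ⟩
  2 ^ suc n       ∎
  where open ≤-Reasoning

2≤2^suc : ∀ s → 2 ≤ 2 ^ suc s
2≤2^suc s = *-monoʳ-≤ 2 (m^n>0 2 s)

firstPart : (f k q : ℕ) → Dec (2 ^ q ≤ suc k) → List (List ℕ)
firstPart f k q (yes _) = map (q ∷_) (compsF f (suc k ∸ 2 ^ q))
firstPart f k q (no _)  = []

-- `Defs` does not export the `where`-bound first-part function of `compsF`, so `laterParts`
-- is pinned to it by unification: once the candidate exponents 0 and 1 are unfolded, the
-- remaining exponent list `applyUpTo (2 +_) k` is neutral and `concatMap` is matched as is.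
mutual
  laterParts : ℕ → ℕ → ℕ → List (List ℕ)
  laterParts = _

  compsF-unfold : ∀ f k → compsF (suc f) (suc k) ≡
    firstPart f k 0 (1 ≤? suc k) ++ (firstPart f k 1 (2 ≤? suc k) ++ concatMap (laterParts f k) (applyUpTo (2 +_) k))
  compsF-unfold f k with 2 ≤? suc k
  ... | yes _ = refl
  ... | no _  = refl

laterParts≗firstPart : ∀ f k q → laterParts f k q ≡ firstPart f k q (2 ^ q ≤? suc k)
laterParts≗firstPart f k q with 2 ^ q ≤? suc k
... | yes _ = refl
... | no _  = refl

compsF-suc : ∀ f k →
  compsF (suc f) (suc k) ≡ concatMap (λ q → firstPart f k q (2 ^ q ≤? suc k)) (upTo (2 + k))
compsF-suc f k = trans (compsF-unfold f k)
  (cong (λ ps → firstPart f k 0 (1 ≤? suc k) ++ (firstPart f k 1 (2 ≤? suc k) ++ ps))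
        (concatMap-cong (laterParts≗firstPart f k) (applyUpTo (2 +_) k)))

length-concatMap-upTo : ∀ {A : Set} (g : ℕ → List A) n →
  length (concatMap g (upTo n)) ≡ Σ< n (λ q → length (g q))
length-concatMap-upTo g zero    = refl
length-concatMap-upTo g (suc n) = begin
  length (concatMap g (upTo (suc n)))          ≡⟨ cong (length ∘ concatMap g) (sym (applyUpTo-∷ʳ id n)) ⟩
  length (concatMap g (upTo n ++ [ n ]))       ≡⟨ cong length (concatMap-++ g (upTo n) [ n ]) ⟩
  length (concatMap g (upTo n) ++ (g n ++ [])) ≡⟨ length-++ (concatMap g (upTo n)) ⟩
  length (concatMap g (upTo n)) + length (g n ++ [])
    ≡⟨ cong₂ _+_ (length-concatMap-upTo g n) (cong length (++-identityʳ (g n))) ⟩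
  Σ< n (λ q → length (g q)) + length (g n)     ∎
  where open ≡-Reasoning

length-firstPart : ∀ f k q →
  length (firstPart f k q (2 ^ q ≤? suc k)) ≡
  Σ< (suc k) (λ a → [ a + 2 ^ q ≡ᵇ suc k ] * length (compsF f a))
length-firstPart f k q with 2 ^ q ≤? suc k
... | yes 2^q≤1+k = begin
  length (map (q ∷_) (compsF f r))
    ≡⟨ length-map (q ∷_) (compsF f r) ⟩
  length (compsF f r)
    ≡⟨ sym (Σ<-pick (λ a → length (compsF f a)) r<1+k) ⟩
  Σ< (suc k) (λ a → [ a ≡ᵇ r ] * length (compsF f a))
    ≡⟨ Σ<-cong (suc k) (λ a _ → cong (_* length (compsF f a)) (gap a)) ⟩
  Σ< (suc k) (λ a → [ a + 2 ^ q ≡ᵇ suc k ] * length (compsF f a)) ∎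
  where
  open ≡-Reasoning
  r : ℕ
  r = suc k ∸ 2 ^ q
  r<1+k : r < suc k
  r<1+k = s≤s (∸-monoʳ-≤ (suc k) (m^n>0 2 q))
  gap : ∀ a → [ a ≡ᵇ r ] ≡ [ a + 2 ^ q ≡ᵇ suc k ]
  gap a = trans (sym (indicator-+ʳ (2 ^ q) a r)) (cong ([ a + 2 ^ q ≡ᵇ_]) (m∸n+n≡m 2^q≤1+k))
... | no 2^q≰1+k = sym (Σ<-zero (suc k) (λ a _ → cong (_* length (compsF f a)) (indicator-≢ (too-big a))))
  where
  too-big : ∀ a → a + 2 ^ q ≢ suc k
  too-big a e = 2^q≰1+k (subst (2 ^ q ≤_) e (m≤n+m (2 ^ q) a))

length-compsF-suc : ∀ f k →
  length (compsF (suc f) (suc k)) ≡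
  Σ< (2 + k) (λ q → Σ< (suc k) (λ a → [ a + 2 ^ q ≡ᵇ suc k ] * length (compsF f a)))
length-compsF-suc f k = begin
  length (compsF (suc f) (suc k))
    ≡⟨ cong length (compsF-suc f k) ⟩
  length (concatMap (λ q → firstPart f k q (2 ^ q ≤? suc k)) (upTo (2 + k)))
    ≡⟨ length-concatMap-upTo (λ q → firstPart f k q (2 ^ q ≤? suc k)) (2 + k) ⟩
  Σ< (2 + k) (λ q → length (firstPart f k q (2 ^ q ≤? suc k)))
    ≡⟨ Σ<-cong (2 + k) (λ q _ → length-firstPart f k q) ⟩
  Σ< (2 + k) (λ q → Σ< (suc k) (λ a → [ a + 2 ^ q ≡ᵇ suc k ] * length (compsF f a))) ∎
  where open ≡-Reasoning

length-compsF-fuel : ∀ f g n → n ≤ f → n ≤ g → length (compsF f n) ≡ length (compsF g n)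
length-compsF-fuel f       g       zero    _          _          = refl
length-compsF-fuel (suc f) (suc g) (suc k) (s≤s k≤f) (s≤s k≤g) =
  trans (length-compsF-suc f k)
    (trans (Σ<-cong (2 + k) (λ q _ → Σ<-cong (suc k) (λ a a<1+k →
              cong ([ a + 2 ^ q ≡ᵇ suc k ] *_)
                (length-compsF-fuel f g a (≤-trans (s≤s⁻¹ a<1+k) k≤f) (≤-trans (s≤s⁻¹ a<1+k) k≤g)))))
      (sym (length-compsF-suc g k)))

length-compsF : ∀ {f n} → n ≤ f → length (compsF f n) ≡ v n
length-compsF {f} {n} n≤f = length-compsF-fuel f n n n≤f ≤-refl

v-suc-byFirstPart : ∀ k → v (suc k) ≡ Σ< (2 + k) (λ q → Σ< (suc k) (λ a → [ a + 2 ^ q ≡ᵇ suc k ] * v a))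
v-suc-byFirstPart k =
  trans (length-compsF-suc k k)
    (Σ<-cong (2 + k) (λ q _ → Σ<-cong (suc k) (λ a a<1+k →
       cong ([ a + 2 ^ q ≡ᵇ suc k ] *_) (length-compsF (s≤s⁻¹ a<1+k)))))

pow2Gaps : ℕ → ℕ → ℕ → ℕ
pow2Gaps K x N = Σ< K (λ s → [ x + 2 ^ suc s ≡ᵇ N ])

pow2Gaps-+ʳ : ∀ K d x N → pow2Gaps K (x + d) (N + d) ≡ pow2Gaps K x N
pow2Gaps-+ʳ K d x N = Σ<-cong K (λ s _ →
  trans (cong ([_≡ᵇ N + d ]) (xy∙z≈xz∙y x d (2 ^ suc s))) (indicator-+ʳ d (x + 2 ^ suc s) N))

pow2Gaps-+ˡ : ∀ K d x N → pow2Gaps K (d + x) (d + N) ≡ pow2Gaps K x N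
pow2Gaps-+ˡ K d x N = trans (cong₂ (pow2Gaps K) (+-comm d x) (+-comm d N)) (pow2Gaps-+ʳ K d x N)

pow2Gaps-extend : ∀ {N K} x → N ≤ K → pow2Gaps K x N ≡ pow2Gaps N x N
pow2Gaps-extend {N} x N≤K = Σ<-extend _ N≤K (λ s N≤s → indicator-≢ (λ e →
  <-irrefl refl (begin-strict
    N              ≤⟨ N≤s ⟩
    s              <⟨ <-trans (n<1+n s) (n<2^n (suc s)) ⟩
    2 ^ suc s      ≤⟨ m≤n+m (2 ^ suc s) x ⟩
    x + 2 ^ suc s  ≡⟨ e ⟩
    N              ∎)))
  where open ≤-Reasoning

pow2Gaps-unitGap : ∀ K x → pow2Gaps K x (suc x) ≡ 0
pow2Gaps-unitGap K x = Σ<-zero K (λ s _ → indicator-≢ (λ e →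
  <-irrefl (sym e) (subst (_≤ x + 2 ^ suc s) (+-comm x 2) (+-monoʳ-≤ x (2≤2^suc s)))))

v-suc : ∀ {K} k → suc k ≤ K → v (suc k) ≡ v k + Σ< k (λ a → pow2Gaps K a (suc k) * v a)
v-suc {K} k 1+k≤K = begin
  v (suc k)                                    ≡⟨ v-suc-byFirstPart k ⟩
  Σ< (2 + k) parts                             ≡⟨ Σ<-head (suc k) parts ⟩
  parts 0 + Σ< (suc k) (λ s → parts (suc s))   ≡⟨ cong₂ _+_ unitPart largerParts ⟩
  v k + Σ< k (λ a → pow2Gaps K a (suc k) * v a) ∎
  where
  open ≡-Reasoning
  parts : ℕ → ℕ
  parts q = Σ< (suc k) (λ a → [ a + 2 ^ q ≡ᵇ suc k ] * v a)

  unitPart : parts 0 ≡ v k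
  unitPart = trans
    (Σ<-cong (suc k) (λ a _ → cong (_* v a)
      (trans (cong ([ a + 1 ≡ᵇ_]) (+-comm 1 k)) (indicator-+ʳ 1 a k))))
    (Σ<-pick {c = k} v ≤-refl)

  largerParts : Σ< (suc k) (λ s → parts (suc s)) ≡ Σ< k (λ a → pow2Gaps K a (suc k) * v a)
  largerParts = begin
    Σ< (suc k) (λ s → parts (suc s))
      ≡⟨ Σ<-swap (suc k) (suc k) (λ s a → [ a + 2 ^ suc s ≡ᵇ suc k ] * v a) ⟩
    Σ< (suc k) (λ a → Σ< (suc k) (λ s → [ a + 2 ^ suc s ≡ᵇ suc k ] * v a))
      ≡⟨ Σ<-cong (suc k) (λ a _ → sym (Σ<-distribʳ-* (suc k) (v a) _)) ⟩
    Σ< k (λ a → pow2Gaps (suc k) a (suc k) * v a) + pow2Gaps (suc k) k (suc k) * v k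
      ≡⟨ cong (λ g → Σ< k (λ a → pow2Gaps (suc k) a (suc k) * v a) + g * v k) (pow2Gaps-unitGap (suc k) k) ⟩
    Σ< k (λ a → pow2Gaps (suc k) a (suc k) * v a) + 0
      ≡⟨ +-identityʳ _ ⟩
    Σ< k (λ a → pow2Gaps (suc k) a (suc k) * v a)
      ≡⟨ Σ<-cong k (λ a _ → cong (_* v a) (sym (pow2Gaps-extend a 1+k≤K))) ⟩
    Σ< k (λ a → pow2Gaps K a (suc k) * v a) ∎

extraTerm : ℕ → ℕ → ℕ → ℕ
extraTerm N a b = Σ< N (λ s → [ a + b + 2 ^ suc s ≡ᵇ N ] * (v a * v b))

-- `extraSum m n` is `extraSumTo (m + n) m n`; the target N is decoupled from m and n so that
-- it stays fixed while a unit moves from n to m.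
extraSumTo : ℕ → ℕ → ℕ → ℕ
extraSumTo N m n = Σ< m (λ a → Σ< n (extraTerm N a))

extraTerm≡pow2Gaps : ∀ N a b → extraTerm N a b ≡ pow2Gaps N (a + b) N * (v a * v b)
extraTerm≡pow2Gaps N a b = sym (Σ<-distribʳ-* N (v a * v b) _)

v*v-suc : ∀ m n → v m * v (suc n) ≡ v m * v n + Σ< n (extraTerm (suc (m + n)) m)
v*v-suc m n = begin
  v m * v (suc n)
    ≡⟨ cong (v m *_) (v-suc n (s≤s (m≤n+m n m))) ⟩
  v m * (v n + Σ< n (λ b → pow2Gaps N b (suc n) * v b))
    ≡⟨ *-distribˡ-+ (v m) (v n) _ ⟩
  v m * v n + v m * Σ< n (λ b → pow2Gaps N b (suc n) * v b)
    ≡⟨ cong (v m * v n +_) (Σ<-distribˡ-* n (v m) _) ⟩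
  v m * v n + Σ< n (λ b → v m * (pow2Gaps N b (suc n) * v b))
    ≡⟨ cong (v m * v n +_) (Σ<-cong n (λ b _ → column b)) ⟩
  v m * v n + Σ< n (extraTerm N m) ∎
  where
  open ≡-Reasoning
  N : ℕ
  N = suc (m + n)
  column : ∀ b → v m * (pow2Gaps N b (suc n) * v b) ≡ extraTerm N m b
  column b = begin
    v m * (pow2Gaps N b (suc n) * v b)   ≡⟨ x∙yz≈y∙xz (v m) (pow2Gaps N b (suc n)) (v b) ⟩
    pow2Gaps N b (suc n) * (v m * v b)   ≡⟨ cong (_* (v m * v b)) (sym (pow2Gaps-+ˡ N m b (suc n))) ⟩
    pow2Gaps N (m + b) (m + suc n) * (v m * v b)
      ≡⟨ cong (λ M → pow2Gaps N (m + b) M * (v m * v b)) (+-suc m n) ⟩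
    pow2Gaps N (m + b) N * (v m * v b)   ≡⟨ sym (extraTerm≡pow2Gaps N m b) ⟩
    extraTerm N m b                      ∎

v-suc*v : ∀ m n → v (suc m) * v n ≡ v m * v n + Σ< m (λ a → extraTerm (suc (m + n)) a n)
v-suc*v m n = begin
  v (suc m) * v n
    ≡⟨ cong (_* v n) (v-suc m (s≤s (m≤m+n m n))) ⟩
  (v m + Σ< m (λ a → pow2Gaps N a (suc m) * v a)) * v n
    ≡⟨ *-distribʳ-+ (v n) (v m) _ ⟩
  v m * v n + Σ< m (λ a → pow2Gaps N a (suc m) * v a) * v n
    ≡⟨ cong (v m * v n +_) (Σ<-distribʳ-* m (v n) _) ⟩
  v m * v n + Σ< m (λ a → pow2Gaps N a (suc m) * v a * v n)
    ≡⟨ cong (v m * v n +_) (Σ<-cong m (λ a _ → row a)) ⟩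
  v m * v n + Σ< m (λ a → extraTerm N a n) ∎
  where
  open ≡-Reasoning
  N : ℕ
  N = suc (m + n)
  row : ∀ a → pow2Gaps N a (suc m) * v a * v n ≡ extraTerm N a n
  row a = begin
    pow2Gaps N a (suc m) * v a * v n     ≡⟨ *-assoc (pow2Gaps N a (suc m)) (v a) (v n) ⟩
    pow2Gaps N a (suc m) * (v a * v n)   ≡⟨ cong (_* (v a * v n)) (sym (pow2Gaps-+ʳ N n a (suc m))) ⟩
    pow2Gaps N (a + n) N * (v a * v n)   ≡⟨ sym (extraTerm≡pow2Gaps N a n) ⟩
    extraTerm N a n                      ∎

shift-invariant : ∀ m n →
  v m * v (suc n) + extraSumTo (suc (m + n)) m (suc n) ≡ v (suc m) * v n + extraSumTo (suc (m + n)) (suc m) n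
shift-invariant m n = begin
  v m * v (suc n) + extraSumTo N m (suc n)
    ≡⟨ cong₂ _+_ (v*v-suc m n) (Σ<-distrib-+ m (λ a → Σ< n (extraTerm N a)) (λ a → extraTerm N a n)) ⟩
  (vv + column) + (E + row)                     ≡⟨ interchange vv column E row ⟩
  (vv + E) + (column + row)                     ≡⟨ cong (vv + E +_) (+-comm column row) ⟩
  (vv + E) + (row + column)                     ≡⟨ interchange vv E row column ⟩
  (vv + row) + (E + column)                     ≡⟨ cong (_+ (E + column)) (sym (v-suc*v m n)) ⟩
  v (suc m) * v n + extraSumTo N (suc m) n      ∎
  where
  open ≡-Reasoning
  N vv E row column : ℕ
  N = suc (m + n)
  vv = v m * v n
  E = extraSumTo N m n
  row = Σ< m (λ a → extraTerm N a n)
  column = Σ< n (extraTerm N m)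

v-+ : ∀ m n → v (m + n) ≡ v m * v n + extraSum m n
v-+ zero    n = sym (trans (+-identityʳ (v n + 0)) (+-identityʳ (v n)))
v-+ (suc m) n = begin
  v (suc m + n)
    ≡⟨ cong v (sym (+-suc m n)) ⟩
  v (m + suc n)
    ≡⟨ v-+ m (suc n) ⟩
  v m * v (suc n) + extraSumTo (m + suc n) m (suc n)
    ≡⟨ cong (λ N → v m * v (suc n) + extraSumTo N m (suc n)) (+-suc m n) ⟩
  v m * v (suc n) + extraSumTo (suc (m + n)) m (suc n) ≡⟨ shift-invariant m n ⟩
  v (suc m) * v n + extraSum (suc m) n ∎
  where open ≡-Reasoning

proposition2 : ((m n : ℕ) → m ≥ 1 → n ≥ 1 → v (m + n) ≡ v m * v n + extraSum m n)
               × ((n : ℕ) → n ≥ 1 → v (n + n) ≡ v n * v n + extraSum n n)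
proposition2 = (λ m n _ _ → v-+ m n) , (λ n _ → v-+ n n)
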